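{- Let $\mathbf{w}$ be a word over $\{r,c\}$ of length $k$ and $n\ge1$. For any decomposition in $\mathrm{BSD}(\mathbf{w},n)$ and any $i,j\in\{1,\dots,n+k\}$ with $|i-j|\le n$, strip $i$ and strip $j$ are comparable.
   Context: Diagrams in English convention (rows top to bottom, columns left to right); the content of the box in row $i$, column $j$ is $j-i$, and a diagonal is the set of boxes of a given content. A border strip is a set of boxes forming a connected skew shape with no $2\times2$ square; its head is its box of maximal content. The simple diagram $(\mathbf{w},n)$ is defined recursively: $(\emptyset,n)$ is the $n\times n$ square; $(c\mathbf{w},n)$ adjoins to $(\mathbf{w},n)$ a new column of $n$ boxes immediately left of the leftmost column with its bottom box in the bottom row; $(r\mathbf{w},n)$ adjoins a new row of $n$ boxes immediately below the bottom row with its leftmost box in the leftmost column. $\mathrm{BSD}(\mathbf{w},n)$ is the set of partitions of the boxes into border strips of exactly $n$ boxes. Diagonals are numbered $n+k,\dots,1$ from the diagonal of the top-right box downward in content; in every decomposition each of these diagonals contains exactly one head, and strip $i$ is the strip whose head lies in diagonal $i$. In a decomposition, a strip $B_a$ is above a strip $B_b$ if there is a path of boxes in the diagram from a box of $B_a$ to a box of $B_b$ moving only down or right by unit steps; $B_a$ is inner to $B_b$ (and $B_b$ outer to $B_a$) if there is a sequence $B_a=B_1,\dots,B_m=B_b$ with each $B_t$ above $B_{t+1}$; two strips are comparable if one is inner to the other. -}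

module Defs where

open import Data.Nat as ℕ using (ℕ)
open import Data.Integer using (ℤ; +_; _+_; _-_; _≤_; _<_; 0ℤ; 1ℤ)
open import Data.Product using (_×_; _,_; ∃; ∃-syntax; Σ-syntax)
open import Data.Sum using (_⊎_)
open import Data.List using (List; []; _∷_; length; concat)
open import Data.List.Membership.Propositional using (_∈_)
open import Data.List.Relation.Unary.Unique.Propositional using (Unique)
open import Relation.Binary.PropositionalEquality using (_≡_)
open import Relation.Binary.Construct.Closure.ReflexiveTransitive using (Star)
open import Relation.Nullary using (¬_)
open import Function.Bundles using (_⇔_)

data Letter : Set where
  r c : Letter

Word : Set
Word = List Letter

-- A box (row , column); rows increase downwards, columns to the right.
Box : Set
Box = ℤ × ℤ

row col content : Box → ℤ
row (i , _) = i
col (_ , j) = j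
content (i , j) = j - i

-- The base square occupies rows 0..n-1, columns 0..n-1.
-- bottomRow / leftCol of the simple diagram (w , n).
bottomRow : Word → ℕ → ℤ
bottomRow [] n = + n - 1ℤ
bottomRow (c ∷ w) n = bottomRow w n
bottomRow (r ∷ w) n = bottomRow w n + 1ℤ

leftCol : Word → ℕ → ℤ
leftCol [] n = 0ℤ
leftCol (c ∷ w) n = leftCol w n - 1ℤ
leftCol (r ∷ w) n = leftCol w n

InDiagram : Word → ℕ → Box → Set
InDiagram [] n (i , j) = (0ℤ ≤ i × i < + n) × (0ℤ ≤ j × j < + n)
InDiagram (c ∷ w) n (i , j) =
  InDiagram w n (i , j)
  ⊎ (j ≡ leftCol w n - 1ℤ × (bottomRow w n - + n < i × i ≤ bottomRow w n))
InDiagram (r ∷ w) n (i , j) =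
  InDiagram w n (i , j)
  ⊎ (i ≡ bottomRow w n + 1ℤ × (leftCol w n ≤ j × j < leftCol w n + + n))

Adjacent : Box → Box → Set
Adjacent (i , j) (i' , j') =
  (i' ≡ i + 1ℤ × j' ≡ j) ⊎ (i ≡ i' + 1ℤ × j' ≡ j)
  ⊎ (i' ≡ i × j' ≡ j + 1ℤ) ⊎ (i' ≡ i × j ≡ j' + 1ℤ)

AdjIn : List Box → Box → Box → Set
AdjIn S a b = a ∈ S × b ∈ S × Adjacent a b

Connected : List Box → Set
Connected S = ∀ {a b} → a ∈ S → b ∈ S → Star (AdjIn S) a b

SkewShape : List Box → Set
SkewShape S = ∀ {i j i' j' a b} → (i , j) ∈ S → (i' , j') ∈ S →
  i ≤ a → a ≤ i' → j ≤ b → b ≤ j' → (a , b) ∈ S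

No2x2 : List Box → Set
No2x2 S = ∀ {i j} → ¬ ((i , j) ∈ S × (i + 1ℤ , j) ∈ S
                       × (i , j + 1ℤ) ∈ S × (i + 1ℤ , j + 1ℤ) ∈ S)

BorderStrip : List Box → Set
BorderStrip S = Unique S × Connected S × SkewShape S × No2x2 S

IsBSD : Word → ℕ → List (List Box) → Set
IsBSD w n Bs =
  (∀ {B} → B ∈ Bs → BorderStrip B × length B ≡ n)
  × Unique (concat Bs)
  × (∀ b → (b ∈ concat Bs) ⇔ InDiagram w n b)

Head : List Box → Box → Set
Head B h = h ∈ B × (∀ {b} → b ∈ B → content b ≤ content h)

-- Diagonal numbering: the top-right box (0 , n-1) has content n-1 and
-- lies in diagonal n+k; so diagonal d has content d - k - 1.
HeadInDiagonal : Word → List Box → ℕ → Set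
HeadInDiagonal w B d = ∃[ h ] (Head B h × content h ≡ + d - + (ℕ.suc (length w)))

Step : Word → ℕ → Box → Box → Set
Step w n (i , j) b' =
  InDiagram w n b' × (b' ≡ (i + 1ℤ , j) ⊎ b' ≡ (i , j + 1ℤ))

Above : Word → ℕ → List Box → List Box → Set
Above w n Ba Bb =
  ∃[ a ] ∃[ b ] (a ∈ Ba × b ∈ Bb × InDiagram w n a × Star (Step w n) a b)

AboveIn : Word → ℕ → List (List Box) → List Box → List Box → Set
AboveIn w n Bs Ba Bb = Ba ∈ Bs × Bb ∈ Bs × Above w n Ba Bb

Inner : Word → ℕ → List (List Box) → List Box → List Box → Set
Inner w n Bs = Star (AboveIn w n Bs)

Comparable : Word → ℕ → List (List Box) → List Box → List Box → Set
Comparable w n Bs Ba Bb = Inner w n Bs Ba Bb ⊎ Inner w n Bs Bb Ba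

module Submission where

-- Let Ba, Bb be strips of a decomposition whose heads ha, hb lie on
-- diagonals at distance d ≤ n, with content ha = content hb + d.  The proof
-- combines three general facts, developed in this order.
--   (1) The simple diagram (w , n) is order-convex, so two of its boxes that
--       are componentwise comparable are joined by a down/right path inside
--       it (a path that exists in any order-convex set of boxes).
--   (2) A border strip meets each diagonal at most once and is connected,
--       so a strip of n boxes with head content e meets every diagonal
--       e, e-1, ..., e-n+1 (a pigeonhole count).
--   (3) Two boxes on the same or on adjacent diagonals are componentwise
--       comparable.
-- By (2), Ba has a box x with content x = content hb + δ, δ ∈ {0, 1}
-- (x = ha when d = 0, the box of content (content ha) - (d - 1) otherwise);
-- by (3) x and hb are comparable and by (1) one strip is above the other.

open import Defs

module StripComparability where
  open import Data.Nat as ℕ using (ℕ; zero; suc; z≤n; s≤s; ∣_-_∣)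
  import Data.Nat.Properties as ℕ
  open import Data.Integer using (ℤ; +_; 0ℤ; 1ℤ; _+_; _-_; -_; _≤_; _<_; +≤+)
  open import Data.Integer.Properties
  open import Data.Integer.Tactic.RingSolver using (solve-∀)
  open import Data.Product using (_×_; _,_; ∃; proj₁; proj₂)
  open import Data.Sum using (_⊎_; inj₁; inj₂)
  open import Data.Empty using (⊥; ⊥-elim)
  open import Data.List using (List; []; _∷_; length)
  open import Data.List.Properties using (length-removeAt′)
  open import Data.List.Membership.Propositional using (_∈_; find; lose)
  open import Data.List.Relation.Unary.Any using (here; there; any?; _─_)
  import Data.List.Relation.Unary.All as All
  open import Data.List.Relation.Unary.Unique.Propositional using (Unique)
  open import Data.List.Relation.Unary.AllPairs using (_∷_)
  open import Data.List.Membership.Propositional.Properties using (∈-concat⁺′)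
  open import Relation.Binary.PropositionalEquality
  open import Relation.Binary.Construct.Closure.ReflexiveTransitive using (Star; ε; _◅_; _◅◅_)
  open import Relation.Nullary using (yes; no)
  open import Relation.Binary.Definitions using (tri<; tri≈; tri>)
  open import Function.Bundles using (Equivalence)
  open import Function.Base using (_∘_)

  NonNeg : ℤ → Set
  NonNeg x = 0ℤ ≤ x

  ≤-by : ∀ {a b} x → NonNeg x → x ≡ b - a → a ≤ b
  ≤-by x x≥0 eq = 0≤i-j⇒j≤i (subst NonNeg eq x≥0)

  <-by : ∀ {a b} x → NonNeg x → x ≡ b - a - 1ℤ → a < b
  <-by {a} {b} x x≥0 eq = suc[i]≤j⇒i<j (≤-by x x≥0 (trans eq (ring a b)))
    where ring : ∀ a b → b - a - 1ℤ ≡ b - (1ℤ + a)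
          ring = solve-∀

  ≢-by : ∀ x → NonNeg x → x ≢ - 1ℤ
  ≢-by _ () refl

  gap : ∀ {a b} → a ≤ b → NonNeg (b - a)
  gap = i≤j⇒0≤j-i

  gap< : ∀ {a b} → a < b → NonNeg (b - a - 1ℤ)
  gap< {a} {b} a<b = subst NonNeg (ring a b) (gap (i<j⇒suc[i]≤j a<b))
    where ring : ∀ a b → b - (1ℤ + a) ≡ b - a - 1ℤ
          ring = solve-∀

  nat : ∀ k → NonNeg (+ k)
  nat k = +≤+ z≤n

  infixl 6 _⊕_
  _⊕_ : ∀ {x y} → NonNeg x → NonNeg y → NonNeg (x + y)
  _⊕_ = +-mono-≤

  ≤+1 : ∀ x → x ≤ x + 1ℤ
  ≤+1 x = i≤i+j x 1ℤ

  -1≤ : ∀ x → x - 1ℤ ≤ x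
  -1≤ x = i-j≤i x 1ℤ

  <+1 : ∀ x → x < x + 1ℤ
  <+1 x = <-by _ (nat 0) (ring x)
    where ring : ∀ x → 0ℤ ≡ x + 1ℤ - x - 1ℤ
          ring = solve-∀

  -1< : ∀ x → x - 1ℤ < x
  -1< x = <-by _ (nat 0) (ring x)
    where ring : ∀ x → 0ℤ ≡ x - (x - 1ℤ) - 1ℤ
          ring = solve-∀

  <⇒≤-1 : ∀ {a b} → a < b → a ≤ b - 1ℤ
  <⇒≤-1 {a} {b} a<b = ≤-by _ (gap< a<b) (ring a b)
    where ring : ∀ a b → b - a - 1ℤ ≡ b - 1ℤ - a
          ring = solve-∀

  ≤+1∧≢⇒≤ : ∀ {a b} → a ≤ b + 1ℤ → a ≢ b + 1ℤ → a ≤ b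
  ≤+1∧≢⇒≤ {a} {b} a≤b+1 a≢b+1 = ≤-by _ (gap< (≤∧≢⇒< a≤b+1 a≢b+1)) (ring a b)
    where ring : ∀ a b → b + 1ℤ - a - 1ℤ ≡ b - a
          ring = solve-∀

  ≤⇒offset : ∀ {a b} → a ≤ b → ∃ λ k → b ≡ a + + k
  ≤⇒offset {a} {b} a≤b = ∣ b - a ∣ᶻ , (begin
      b                ≡⟨ ring a b ⟩
      a + (b - a)      ≡⟨ cong (λ t → a + t) (sym (0≤i⇒+∣i∣≡i (gap a≤b))) ⟩
      a + + ∣ b - a ∣ᶻ ∎)
    where open ≡-Reasoning
          open Data.Integer using () renaming (∣_∣ to ∣_∣ᶻ)
          ring : ∀ a b → b ≡ a + (b - a)
          ring = solve-∀

  -- Monotone paths in order-convex sets of boxes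

  OrderConvex : (Box → Set) → Set
  OrderConvex P = ∀ {i j i' j' a b} → P (i , j) → P (i' , j') →
    i ≤ a → a ≤ i' → j ≤ b → b ≤ j' → P (a , b)

  -- A unit step down or right into P; for P = InDiagram w n this is Step w n.
  UnitStep : (Box → Set) → Box → Box → Set
  UnitStep P (i , j) b = P b × (b ≡ (i + 1ℤ , j) ⊎ b ≡ (i , j + 1ℤ))

  walk-offset : ∀ {P : Box → Set} {R : Box → Box → Set} (f : ℤ → Box) →
    (∀ t → P (f (t + 1ℤ)) → R (f t) (f (t + 1ℤ))) →
    ∀ {a} k → (∀ {s} → a ≤ s → s ≤ a + + k → P (f s)) → Star R (f a) (f (a + + k))
  walk-offset {P} {R} f move {a} zero _ =
    subst (λ t → Star R (f a) (f t)) (sym (+-identityʳ a)) ε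
  walk-offset {P} {R} f move {a} (suc k) onSegment =
    move a (onSegment (≤+1 a) (≤-trans (i≤i+j (a + 1ℤ) (+ k)) (≤-reflexive shift)))
    ◅ subst (λ t → Star R (f (a + 1ℤ)) (f t)) shift
        (walk-offset {P} f move k
          (λ lo hi → onSegment (≤-trans (≤+1 a) lo) (≤-trans hi (≤-reflexive shift))))
    where shift : a + 1ℤ + + k ≡ a + + suc k
          shift = +-assoc a 1ℤ (+ k)

  walk : ∀ {P : Box → Set} {R : Box → Box → Set} (f : ℤ → Box) →
    (∀ t → P (f (t + 1ℤ)) → R (f t) (f (t + 1ℤ))) →
    ∀ {a b} → a ≤ b → (∀ {s} → a ≤ s → s ≤ b → P (f s)) → Star R (f a) (f b)
  walk {P} f move a≤b onSegment with ≤⇒offset a≤b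
  ... | k , refl = walk-offset {P} f move k onSegment

  monotone-path : ∀ {P} → OrderConvex P → ∀ {i j i' j'} → P (i , j) → P (i' , j') →
    i ≤ i' → j ≤ j' → Star (UnitStep P) (i , j) (i' , j')
  monotone-path {P} convex {i} {j} {i'} {j'} p q i≤i' j≤j' =
    walk {P} (λ t → t , j) (λ _ r → r , inj₁ refl) i≤i' (λ lo hi → convex p q lo hi ≤-refl j≤j')
    ◅◅ walk {P} (λ t → i' , t) (λ _ r → r , inj₂ refl) j≤j'
         (λ lo hi → convex p q i≤i' ≤-refl lo hi)

  -- The simple diagram (w , n) is order-convex

  diagram-bounds : ∀ w n {i j} → InDiagram w n (i , j) → leftCol w n ≤ j × i ≤ bottomRow w n
  diagram-bounds [] n {i} ((_ , i<n) , (0≤j , _)) = 0≤j , <⇒≤-1 i<n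
  diagram-bounds (c ∷ w) n (inj₁ old) with diagram-bounds w n old
  ... | L≤j , i≤B = ≤-trans (-1≤ (leftCol w n)) L≤j , i≤B
  diagram-bounds (c ∷ w) n (inj₂ (refl , _ , i≤B)) = ≤-refl , i≤B
  diagram-bounds (r ∷ w) n (inj₁ old) with diagram-bounds w n old
  ... | L≤j , i≤B = L≤j , ≤-trans i≤B (≤+1 (bottomRow w n))
  diagram-bounds (r ∷ w) n (inj₂ (refl , L≤j , _)) = L≤j , ≤-refl

  left-column : ∀ w n {i} → bottomRow w n - + n < i → i ≤ bottomRow w n →
    InDiagram w n (i , leftCol w n)
  left-column [] n {i} lo hi = (0≤i , i<n) , (≤-refl , ≤-<-trans 0≤i i<n)
    where
    ring₁ : ∀ i m → i - (m - 1ℤ - m) - 1ℤ ≡ i - 0ℤ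
    ring₁ = solve-∀
    ring₂ : ∀ i m → m - 1ℤ - i ≡ m - i - 1ℤ
    ring₂ = solve-∀
    0≤i : 0ℤ ≤ i
    0≤i = ≤-by _ (gap< lo) (ring₁ i (+ n))
    i<n : i < + n
    i<n = <-by _ (gap hi) (ring₂ i (+ n))
  left-column (c ∷ w) n lo hi = inj₂ (refl , lo , hi)
  left-column (r ∷ w) n {i} lo hi with i ≟ bottomRow w n + 1ℤ
  ... | yes refl = inj₂ (refl , ≤-refl , <-by _ (gap< lo) (ring (leftCol w n) (bottomRow w n) (+ n)))
    where ring : ∀ L B m → B + 1ℤ - (B + 1ℤ - m) - 1ℤ ≡ L + m - L - 1ℤ
          ring = solve-∀
  ... | no i≢B+1 = inj₁ (left-column w n lo′ (≤+1∧≢⇒≤ hi i≢B+1))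
    where ring : ∀ i B m → i - (B + 1ℤ - m) - 1ℤ + 1ℤ ≡ i - (B - m) - 1ℤ
          ring = solve-∀
          lo′ : bottomRow w n - + n < i
          lo′ = <-by _ (gap< lo ⊕ nat 1) (ring i (bottomRow w n) (+ n))

  bottom-row : ∀ w n {j} → leftCol w n ≤ j → j < leftCol w n + + n →
    InDiagram w n (bottomRow w n , j)
  bottom-row [] n {j} lo hi = (0≤B , B<n) , (lo , j<n)
    where
    ring₁ : ∀ j m → j - 0ℤ + (0ℤ + m - j - 1ℤ) ≡ m - 1ℤ - 0ℤ
    ring₁ = solve-∀
    ring₂ : ∀ m → 0ℤ ≡ m - (m - 1ℤ) - 1ℤ
    ring₂ = solve-∀
    0≤B : 0ℤ ≤ + n - 1ℤ
    0≤B = ≤-by _ (gap lo ⊕ gap< hi) (ring₁ j (+ n))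
    B<n : + n - 1ℤ < + n
    B<n = <-by _ (nat 0) (ring₂ (+ n))
    j<n : j < + n
    j<n = subst (j <_) (+-identityˡ (+ n)) hi
  bottom-row (c ∷ w) n {j} lo hi with j ≟ leftCol w n - 1ℤ
  ... | yes refl = inj₂ (refl , <-by _ (gap< hi) (ring (leftCol w n) (bottomRow w n) (+ n)) , ≤-refl)
    where ring : ∀ L B m → L - 1ℤ + m - (L - 1ℤ) - 1ℤ ≡ B - (B - m) - 1ℤ
          ring = solve-∀
  ... | no j≢L-1 = inj₁ (bottom-row w n L≤j j<L+n)
    where ring₁ : ∀ j L → j - (L - 1ℤ) - 1ℤ ≡ j - L
          ring₁ = solve-∀
          ring₂ : ∀ j L m → L - 1ℤ + m - j - 1ℤ + 1ℤ ≡ L + m - j - 1ℤ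
          ring₂ = solve-∀
          L≤j : leftCol w n ≤ j
          L≤j = ≤-by _ (gap< (≤∧≢⇒< lo (j≢L-1 ∘ sym))) (ring₁ j (leftCol w n))
          j<L+n : j < leftCol w n + + n
          j<L+n = <-by _ (gap< hi ⊕ nat 1) (ring₂ j (leftCol w n) (+ n))
  bottom-row (r ∷ w) n lo hi = inj₂ (refl , lo , hi)

  -- When both boxes come from the same part (the old
  -- diagram or the added column/row) this is immediate; an old box cannot lie
  -- weakly right of a box of the column added by c, nor weakly below a box of
  -- the row added by r; in the remaining mixed case, the box between them is
  -- either in the added column/row or between an old box and a box of the
  -- old left column/bottom row, which are full.
  diagram-convex : ∀ w n → OrderConvex (InDiagram w n)
  diagram-convex [] n ((0≤i , _) , (0≤j , _)) ((_ , i'<n) , (_ , j'<n)) i≤a a≤i' j≤b b≤j' =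
    (≤-trans 0≤i i≤a , ≤-<-trans a≤i' i'<n) , (≤-trans 0≤j j≤b , ≤-<-trans b≤j' j'<n)
  diagram-convex (c ∷ w) n (inj₁ p) (inj₁ q) i≤a a≤i' j≤b b≤j' =
    inj₁ (diagram-convex w n p q i≤a a≤i' j≤b b≤j')
  diagram-convex (c ∷ w) n (inj₁ p) (inj₂ (refl , _)) i≤a a≤i' j≤b b≤j' =
    ⊥-elim (<⇒≱ (-1< (leftCol w n)) (≤-trans (proj₁ (diagram-bounds w n p)) (≤-trans j≤b b≤j')))
  diagram-convex (c ∷ w) n (inj₂ (refl , lo , _)) (inj₂ (refl , _ , hi')) i≤a a≤i' j≤b b≤j' =
    inj₂ (≤-antisym b≤j' j≤b , <-≤-trans lo i≤a , ≤-trans a≤i' hi')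
  diagram-convex (c ∷ w) n {b = b} (inj₂ (refl , lo , hi)) (inj₁ q) i≤a a≤i' j≤b b≤j'
    with b ≟ leftCol w n - 1ℤ
  ... | yes b≡L-1 = inj₂ (b≡L-1 , <-≤-trans lo i≤a , ≤-trans a≤i' (proj₂ (diagram-bounds w n q)))
  ... | no b≢L-1 = inj₁ (diagram-convex w n (left-column w n lo hi) q i≤a a≤i' L≤b b≤j')
    where ring : ∀ b L → b - (L - 1ℤ) - 1ℤ ≡ b - L
          ring = solve-∀
          L≤b : leftCol w n ≤ b
          L≤b = ≤-by _ (gap< (≤∧≢⇒< j≤b (b≢L-1 ∘ sym))) (ring b (leftCol w n))
  diagram-convex (r ∷ w) n (inj₁ p) (inj₁ q) i≤a a≤i' j≤b b≤j' =
    inj₁ (diagram-convex w n p q i≤a a≤i' j≤b b≤j')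
  diagram-convex (r ∷ w) n (inj₂ (refl , _)) (inj₁ q) i≤a a≤i' j≤b b≤j' =
    ⊥-elim (<⇒≱ (<+1 (bottomRow w n)) (≤-trans i≤a (≤-trans a≤i' (proj₂ (diagram-bounds w n q)))))
  diagram-convex (r ∷ w) n (inj₂ (refl , lo , _)) (inj₂ (refl , _ , hi')) i≤a a≤i' j≤b b≤j' =
    inj₂ (≤-antisym a≤i' i≤a , ≤-trans lo j≤b , ≤-<-trans b≤j' hi')
  diagram-convex (r ∷ w) n {a = a} (inj₁ p) (inj₂ (refl , lo' , hi')) i≤a a≤i' j≤b b≤j'
    with a ≟ bottomRow w n + 1ℤ
  ... | yes a≡B+1 = inj₂ (a≡B+1 , ≤-trans (proj₁ (diagram-bounds w n p)) j≤b , ≤-<-trans b≤j' hi')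
  ... | no a≢B+1 =
    inj₁ (diagram-convex w n p (bottom-row w n lo' hi') i≤a (≤+1∧≢⇒≤ a≤i' a≢B+1) j≤b b≤j')

  -- Border strips meet consecutive diagonals

  -- Two boxes (a , b), (a' , b') with a < a' on one diagonal of a skew shape
  -- force the square (a , b), (a + 1 , b), (a , b + 1), (a + 1 , b + 1) into it.
  diagonal-square : ∀ {S} → SkewShape S → No2x2 S → ∀ {a b a' b'} →
    (a , b) ∈ S → (a' , b') ∈ S → b - a ≡ b' - a' → a < a' → ⊥
  diagonal-square skew no2x2 {a} {b} {a'} {b'} x∈ y∈ same a<a' =
    no2x2 (x∈ , skew x∈ y∈ (≤+1 a) a+1≤a' ≤-refl b≤b' ,
                skew x∈ y∈ ≤-refl (<⇒≤ a<a') (≤+1 b) b+1≤b' ,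
                skew x∈ y∈ (≤+1 a) a+1≤a' (≤+1 b) b+1≤b')
    where
    ring₁ : ∀ a a' → a' - a - 1ℤ ≡ a' - (a + 1ℤ)
    ring₁ = solve-∀
    ring₂ : ∀ a b a' b' → a' - a - 1ℤ + (b' - a' - (b - a)) ≡ b' - (b + 1ℤ)
    ring₂ = solve-∀
    a+1≤a' : a + 1ℤ ≤ a'
    a+1≤a' = ≤-by _ (gap< a<a') (ring₁ a a')
    b+1≤b' : b + 1ℤ ≤ b'
    b+1≤b' = ≤-by _ (gap< a<a' ⊕ gap (≤-reflexive same)) (ring₂ a b a' b')
    b≤b' : b ≤ b'
    b≤b' = ≤-trans (≤+1 b) b+1≤b'

  diagonal-injective : ∀ {S} → SkewShape S → No2x2 S → ∀ {x y} → x ∈ S → y ∈ S →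
    content x ≡ content y → x ≡ y
  diagonal-injective skew no2x2 {a , b} {a' , b'} x∈ y∈ same with <-cmp a a'
  ... | tri< a<a' _ _ = ⊥-elim (diagonal-square skew no2x2 x∈ y∈ same a<a')
  ... | tri> _ _ a>a' = ⊥-elim (diagonal-square skew no2x2 y∈ x∈ (sym same) a>a')
  ... | tri≈ _ refl _ = cong (a ,_) (begin
      b            ≡⟨ ring b a ⟩
      (b - a) + a  ≡⟨ cong (_+ a) same ⟩
      (b' - a) + a ≡⟨ ring b' a ⟨
      b'           ∎)
    where open ≡-Reasoning
          ring : ∀ b a → b ≡ (b - a) + a
          ring = solve-∀

  adjacent-content : ∀ x y → Adjacent x y →
    content y ≡ content x - 1ℤ ⊎ content y ≡ content x + 1ℤ
  adjacent-content (i , j) _ (inj₁ (refl , refl)) = inj₁ (below i j)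
    where below : ∀ i j → j - (i + 1ℤ) ≡ j - i - 1ℤ
          below = solve-∀
  adjacent-content (_ , j) (i' , _) (inj₂ (inj₁ (refl , refl))) = inj₂ (above i' j)
    where above : ∀ i j → j - i ≡ j - (i + 1ℤ) + 1ℤ
          above = solve-∀
  adjacent-content (i , j) _ (inj₂ (inj₂ (inj₁ (refl , refl)))) = inj₂ (right i j)
    where right : ∀ i j → j + 1ℤ - i ≡ j - i + 1ℤ
          right = solve-∀
  adjacent-content (i , _) (_ , j') (inj₂ (inj₂ (inj₂ (refl , refl)))) = inj₁ (left i j')
    where left : ∀ i j → j - i ≡ j + 1ℤ - i - 1ℤ
          left = solve-∀

  -- Removing the image of the first element
  -- from ys leaves room for the images of the others.
  ∈-─ : ∀ {A : Set} {x z : A} {ys} (x∈ : x ∈ ys) → z ∈ ys → z ≢ x → z ∈ (ys ─ x∈)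
  ∈-─ (here refl) (here refl) z≢x = ⊥-elim (z≢x refl)
  ∈-─ (here _) (there z∈) _ = z∈
  ∈-─ (there _) (here refl) _ = here refl
  ∈-─ (there x∈) (there z∈) z≢x = there (∈-─ x∈ z∈ z≢x)

  pigeonhole : ∀ {A B : Set} (f : A → B) {xs : List A} {ys : List B} → Unique xs →
    (∀ {x y} → x ∈ xs → y ∈ xs → f x ≡ f y → x ≡ y) →
    (∀ {x} → x ∈ xs → f x ∈ ys) → length xs ℕ.≤ length ys
  pigeonhole f {[]} _ _ _ = z≤n
  pigeonhole f {x ∷ xs} {ys} (x∉xs ∷ unique) injective into =
    subst (suc (length xs) ℕ.≤_) (sym (length-removeAt′ ys _))
      (s≤s (pigeonhole f unique (λ p q → injective (there p) (there q)) into-rest))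
    where
    into-rest : ∀ {x'} → x' ∈ xs → f x' ∈ (ys ─ into (here refl))
    into-rest x'∈ = ∈-─ (into (here refl)) (into (there x'∈))
      (λ same → All.lookup x∉xs x'∈ (injective (here refl) (there x'∈) (sym same)))

  interval : ℤ → ℕ → List ℤ
  interval e zero = []
  interval e (suc m) = e + + suc m ∷ interval e m

  length-interval : ∀ e m → length (interval e m) ≡ m
  length-interval e zero = refl
  length-interval e (suc m) = cong suc (length-interval e m)

  ∈-interval : ∀ e m {z} → e < z → z ≤ e + + m → z ∈ interval e m
  ∈-interval e zero {z} e<z z≤e = ⊥-elim (≢-by _ (gap< e<z ⊕ gap z≤e) (ring e z))
    where ring : ∀ e z → z - e - 1ℤ + (e + 0ℤ - z) ≡ - 1ℤ
          ring = solve-∀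
  ∈-interval e (suc m) {z} e<z z≤e+m+1 with z ≟ e + + suc m
  ... | yes z≡e+m+1 = here z≡e+m+1
  ... | no z≢e+m+1 =
    there (∈-interval e m e<z (≤-by _ (gap< (≤∧≢⇒< z≤e+m+1 z≢e+m+1)) (ring e z (+ m))))
    where ring : ∀ e z k → e + (1ℤ + k) - z - 1ℤ ≡ e + k - z
          ring = solve-∀

  -- If one were missed, connectivity from h would keep all contents in
  -- (content h - m , content h], an interval of only m integers, while the
  -- boxes of the strip have pairwise distinct contents.
  strip-covers-diagonals : ∀ {S h} → BorderStrip S → Head S h → ∀ m → m ℕ.< length S →
    ∃ λ x → x ∈ S × content x ≡ content h - + m
  strip-covers-diagonals {S} {h} (unique , connected , skew , no2x2) (h∈ , maximal) m m<|S|
    with any? (λ x → content x ≟ content h - + m) S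
  ... | yes hit = find hit
  ... | no miss = ⊥-elim (ℕ.<⇒≱ m<|S| (subst (length S ℕ.≤_) (length-interval e m)
                    (pigeonhole content unique (diagonal-injective skew no2x2) into)))
    where
    e : ℤ
    e = content h - + m
    avoids : ∀ {x} → x ∈ S → content x ≢ e
    avoids x∈ hit = miss (lose x∈ hit)
    stays-above : ∀ {a b} → e < content a → Star (AdjIn S) a b → e < content b
    stays-above e<a ε = e<a
    stays-above {a} e<a ((_ , y∈ , adj) ◅ path) with adjacent-content _ _ adj
    ... | inj₁ down =
      stays-above (≤∧≢⇒< (subst (e ≤_) (sym down) (<⇒≤-1 e<a)) (avoids y∈ ∘ sym)) path
    ... | inj₂ up = stays-above (subst (e <_) (sym up) (<-trans e<a (<+1 (content a)))) path
    e<h : e < content h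
    e<h = ≤∧≢⇒< (i-j≤i (content h) (+ m)) (avoids h∈ ∘ sym)
    ring : ∀ c k → c ≡ c - k + k
    ring = solve-∀
    into : ∀ {x} → x ∈ S → content x ∈ interval e m
    into x∈ = ∈-interval e m (stays-above e<h (connected h∈ x∈))
      (≤-trans (maximal x∈) (≤-reflexive (ring (content h) (+ m))))

  -- Comparability of strips

  _≼_ : Box → Box → Set
  (i , j) ≼ (i' , j') = i ≤ i' × j ≤ j'

  NearDiagonal : ℤ → Box → Set
  NearDiagonal e x = ∃ λ δ → 0ℤ ≤ δ × δ ≤ 1ℤ × content x ≡ e + δ

  near-diagonal-comparable : ∀ {x y} → NearDiagonal (content y) x → x ≼ y ⊎ y ≼ x
  near-diagonal-comparable {p , q} {p' , q'} (δ , 0≤δ , δ≤1 , same) with p <? p'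
  ... | yes p<p' =
    inj₁ (<⇒≤ p<p' , ≤-by _ (gap< p<p' ⊕ gap δ≤1 ⊕ gap (≤-reflexive same)) (ring p q p' q' δ))
    where ring : ∀ p q p' q' δ → p' - p - 1ℤ + (1ℤ - δ) + (q' - p' + δ - (q - p)) ≡ q' - q
          ring = solve-∀
  ... | no p≮p' =
    inj₂ (p'≤p , ≤-by _ (gap p'≤p ⊕ gap 0≤δ ⊕ gap (≤-reflexive (sym same))) (ring p q p' q' δ))
    where ring : ∀ p q p' q' δ → p - p' + (δ - 0ℤ) + (q - p - (q' - p' + δ)) ≡ q - q'
          ring = solve-∀
          p'≤p : p' ≤ p
          p'≤p = ≮⇒≥ p≮p'

  -- A strip whose head lies d ≤ |S| diagonals above the diagonal of content e
  -- has a box near that diagonal: its head if d = 0, otherwise its box of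
  -- content e + 1, which exists by strip-covers-diagonals.
  strip-reaches-diagonal : ∀ {S h} e d → BorderStrip S → Head S h →
    content h ≡ e + + d → d ℕ.≤ length S → ∃ λ x → x ∈ S × NearDiagonal e x
  strip-reaches-diagonal e zero _ (h∈ , _) h-on-e _ = _ , h∈ , 0ℤ , ≤-refl , +≤+ z≤n , h-on-e
  strip-reaches-diagonal {h = h} e (suc m) strip head h-above d≤|S|
    with strip-covers-diagonals strip head m d≤|S|
  ... | x , x∈ , x-on = x , x∈ , 1ℤ , +≤+ z≤n , ≤-refl , (begin
      content x         ≡⟨ x-on ⟩
      content h - + m   ≡⟨ cong (_- + m) h-above ⟩
      e + + suc m - + m ≡⟨ ring e (+ m) ⟩
      e + 1ℤ            ∎)
    where open ≡-Reasoning
          ring : ∀ e k → e + (1ℤ + k) - k ≡ e + 1ℤ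
          ring = solve-∀

  -- In a decomposition, a box of Ba weakly northwest of a box of Bb makes Ba
  -- above Bb: both boxes lie in the order-convex diagram, so a monotone path joins them.
  above-by-boxes : ∀ {w n Bs Ba Bb x y} → IsBSD w n Bs → Ba ∈ Bs → Bb ∈ Bs →
    x ∈ Ba → y ∈ Bb → x ≼ y → AboveIn w n Bs Ba Bb
  above-by-boxes {w} {n} {Bs} {x = i , j} {i' , j'} (_ , _ , cover) Ba∈ Bb∈ x∈ y∈ (i≤i' , j≤j') =
    Ba∈ , Bb∈ , _ , _ , x∈ , y∈ , in-x ,
    monotone-path (diagram-convex w n) in-x (in-diagram y∈ Bb∈) i≤i' j≤j'
    where
    in-diagram : ∀ {z B} → z ∈ B → B ∈ Bs → InDiagram w n z
    in-diagram z∈ B∈ = Equivalence.to (cover _) (∈-concat⁺′ z∈ B∈)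
    in-x : InDiagram w n (i , j)
    in-x = in-diagram x∈ Ba∈

  diagonal-gap : ∀ {x y} (K : ℕ) {i j} → j ℕ.≤ i →
    content x ≡ + i - + K → content y ≡ + j - + K →
    content x ≡ content y + + (i ℕ.∸ j)
  diagonal-gap {x} {y} K {i} {j} j≤i x-on y-on = begin
    content x                 ≡⟨ x-on ⟩
    + i - + K                 ≡⟨ cong (λ t → + t - + K) (sym (ℕ.m∸n+n≡m j≤i)) ⟩
    + (i ℕ.∸ j) + + j - + K   ≡⟨ ring (+ (i ℕ.∸ j)) (+ j) (+ K) ⟩
    + j - + K + + (i ℕ.∸ j)   ≡⟨ cong (_+ + (i ℕ.∸ j)) y-on ⟨
    content y + + (i ℕ.∸ j)   ∎
    where open ≡-Reasoning
          ring : ∀ d j K → d + j - K ≡ j - K + d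
          ring = solve-∀

  heads-near⇒comparable : ∀ {w n Bs Ba Bb ha hb} d → IsBSD w n Bs → Ba ∈ Bs → Bb ∈ Bs →
    Head Ba ha → Head Bb hb → content ha ≡ content hb + + d → d ℕ.≤ n →
    Comparable w n Bs Ba Bb
  heads-near⇒comparable {hb = hb} d bsd@(strips , _) Ba∈ Bb∈ Ha (hb∈ , _) ha-above d≤n
    with strips Ba∈
  ... | strip , |Ba|≡n
    with strip-reaches-diagonal (content hb) d strip Ha ha-above (subst (d ℕ.≤_) (sym |Ba|≡n) d≤n)
  ...   | x , x∈ , near with near-diagonal-comparable {x} {hb} near
  ...     | inj₁ x≼hb = inj₁ (above-by-boxes bsd Ba∈ Bb∈ x∈ hb∈ x≼hb ◅ ε)
  ...     | inj₂ hb≼x = inj₂ (above-by-boxes bsd Bb∈ Ba∈ hb∈ x∈ hb≼x ◅ ε)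

  diagonals-near⇒comparable : ∀ {w n Bs Bi Bj i j} → IsBSD w n Bs → Bi ∈ Bs → Bj ∈ Bs →
    HeadInDiagonal w Bi i → HeadInDiagonal w Bj j → j ℕ.≤ i → ∣ i - j ∣ ℕ.≤ n →
    Comparable w n Bs Bi Bj
  diagonals-near⇒comparable {w} {n} bsd Bi∈ Bj∈ (hi , Hi , hi-on) (hj , Hj , hj-on) j≤i ∣i-j∣≤n =
    heads-near⇒comparable _ bsd Bi∈ Bj∈ Hi Hj (diagonal-gap {hi} {hj} (suc (length w)) j≤i hi-on hj-on)
      (subst (ℕ._≤ n) (ℕ.m≤n⇒∣n-m∣≡n∸m j≤i) ∣i-j∣≤n)

open StripComparability using (diagonals-near⇒comparable)
open import Data.Nat using (ℕ; _≤_; _+_; ∣_-_∣)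
import Data.Nat.Properties as ℕ
open import Data.List using (List; length)
open import Data.List.Membership.Propositional using (_∈_)
open import Data.Sum using (inj₁; inj₂; swap)
open import Relation.Binary.PropositionalEquality using (subst)

mainTheorem8 : (w : Word) (n : ℕ) → 1 ≤ n →
    (Bs : List (List Box)) → IsBSD w n Bs →
    (i j : ℕ) → 1 ≤ i → i ≤ n + length w → 1 ≤ j → j ≤ n + length w →
    ∣ i - j ∣ ≤ n →
    (Bi Bj : List Box) → Bi ∈ Bs → Bj ∈ Bs →
    HeadInDiagonal w Bi i → HeadInDiagonal w Bj j →
    Comparable w n Bs Bi Bj
mainTheorem8 w n _ Bs bsd i j _ _ _ _ ∣i-j∣≤n Bi Bj Bi∈ Bj∈ Hi Hj with ℕ.≤-total j i
... | inj₁ j≤i = diagonals-near⇒comparable bsd Bi∈ Bj∈ Hi Hj j≤i ∣i-j∣≤n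
... | inj₂ i≤j = swap (diagonals-near⇒comparable bsd Bj∈ Bi∈ Hj Hi i≤j
                      (subst (_≤ n) (ℕ.∣-∣-comm i j) ∣i-j∣≤n))
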